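{- If $G$ is a connected bipartite multigraph with $|V(G)|\leq 4$, then $G\in\mathfrak{N}$.
   Context: Multigraphs are finite and may have multiple edges but no loops. A proper edge-coloring of a multigraph assigns colors to edges so that no two edges sharing an endpoint receive the same color. An interval $t$-coloring of a multigraph $G$ is a proper edge-coloring with colors $1,\ldots,t$ such that every color is used and for every vertex $v$ the set of colors of edges incident to $v$ is an interval of integers. $\mathfrak{N}$ denotes the set of multigraphs having an interval $t$-coloring for some positive integer $t$. -}

module Defs where

open import Data.Nat using (ℕ; _≤_; _<_)
open import Data.Fin using (Fin)
open import Data.Bool using (Bool)
open import Data.Product using (_×_; proj₁; proj₂; Σ; ∃; ∃-syntax)
open import Data.Sum using (_⊎_)
open import Relation.Nullary using (¬_)
open import Relation.Binary.PropositionalEquality using (_≡_)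

-- A finite multigraph without loops: vertices Fin n, edges Fin m,
-- each edge has two (distinct) endpoints.  Parallel edges are allowed
-- since distinct edge indices may have equal endpoints.
record Multigraph : Set where
  field
    n     : ℕ
    m     : ℕ
    ends  : Fin m → Fin n × Fin n
    loopless : (e : Fin m) → ¬ (proj₁ (ends e) ≡ proj₂ (ends e))

open Multigraph public

Incident : (G : Multigraph) → Fin (n G) → Fin (m G) → Set
Incident G v e = (proj₁ (ends G e) ≡ v) ⊎ (proj₂ (ends G e) ≡ v)

data Walk (G : Multigraph) : Fin (n G) → Fin (n G) → Set where
  here : ∀ {u} → Walk G u u
  step : ∀ {u w v} (e : Fin (m G)) → Incident G u e → Incident G w e →
         Walk G w v → Walk G u v

Connected : Multigraph → Set
Connected G = ∀ (u v : Fin (n G)) → Walk G u v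

Bipartite : Multigraph → Set
Bipartite G = Σ (Fin (n G) → Bool) λ side →
  ∀ (e : Fin (m G)) → ¬ (side (proj₁ (ends G e)) ≡ side (proj₂ (ends G e)))

record IntervalColoring (G : Multigraph) (t : ℕ) : Set where
  field
    col    : Fin (m G) → ℕ
    range  : ∀ e → 1 ≤ col e × col e ≤ t
    proper : ∀ (e f : Fin (m G)) (v : Fin (n G)) →
             Incident G v e → Incident G v f → col e ≡ col f → e ≡ f
    allUsed : ∀ (k : ℕ) → 1 ≤ k → k ≤ t → ∃[ e ] col e ≡ k
    interval : ∀ (v : Fin (n G)) (e f : Fin (m G)) (k : ℕ) →
               Incident G v e → Incident G v f → col e ≤ k → k ≤ col f →
               ∃[ g ] (Incident G v g × col g ≡ k)

InN : Multigraph → Set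
InN G = ∃[ t ] (1 ≤ t × IntervalColoring G t)

module Submission where

-- Connectivity (with at least two vertices) only serves to provide
-- an edge e₀ = c d; the sides of c and d are then analysed.
--
-- * If one side consists of a single vertex u, every edge contains u: the graph
--   is a star.  Sorting the edges by their other endpoint and colouring them
--   1, 2, … in that order is an interval colouring (module Star).
-- * Otherwise both sides contain a second vertex, and as there are at most four
--   vertices (Fin n holds at most n distinct points, lemma distinct-bound) the
--   sides are {a₀, a₁} and {b₀, b₁}.  Edges of class (x , y), joining aₓ and b_y,
--   receive consecutive blocks: the classes (x , x) end at a common colour h,
--   the classes (x , ¬ x) start right after h.  Every vertex meets exactly one
--   class ending at h and one starting after it (module Square).

open import Defs
open import Data.Nat
  using (ℕ; zero; suc; _+_; _∸_; _⊔_; _≤_; _<_; _≤′_; ≤′-refl; ≤′-step; z≤n; s≤s; _≤?_; _<?_)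
open import Data.Nat.Properties hiding (_≟_)
import Data.Nat.Properties as ℕₚ
open import Data.Fin using (Fin; zero; suc; toℕ; punchOut; _≟_)
open import Data.Fin.Properties using (toℕ-injective; toℕ<n; punchOut-injective; any?)
open import Data.Bool using (Bool; true; false; not; if_then_else_)
import Data.Bool.Properties as Boolₚ
open import Data.Bool.Properties using (not-¬; ¬-not)
open import Data.List using (List; []; _∷_; length)
open import Data.List.Relation.Unary.All using (All; []; _∷_)
open import Data.List.Relation.Unary.AllPairs using (AllPairs; []; _∷_)
open import Data.Product using (_×_; _,_; proj₁; proj₂; ∃-syntax; Σ-syntax)
open import Data.Product.Properties using (≡-dec)
open import Data.Sum using (_⊎_; inj₁; inj₂)
import Data.Sum as Sum
open import Function using (_∘_; _⇔_; mk⇔; Equivalence)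
open import Function.Properties.Equivalence using () renaming (trans to ⇔-trans)
open import Relation.Binary.Definitions using (DecidableEquality; tri<; tri≈; tri>)
open import Relation.Binary.PropositionalEquality
  using (_≡_; _≢_; refl; sym; trans; cong; cong₂; subst; subst₂; module ≡-Reasoning)
open import Relation.Nullary using (yes; no; does; ¬_; contradiction; ¬?)
open import Relation.Nullary.Decidable using (_×-dec_; dec-true; dec-false; decidable-stable)
open import Relation.Unary using (Decidable)

open Equivalence using (to; from)

count : ∀ {m} {P : Fin m → Set} → Decidable P → ℕ
count {zero}  P? = 0
count {suc m} P? with P? zero
... | yes _ = suc (count (λ i → P? (suc i)))
... | no  _ = count (λ i → P? (suc i))

rank : ∀ {m} {P : Fin m → Set} → Decidable P → Fin m → ℕ
rank P? zero = 0
rank P? (suc e) with P? zero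
... | yes _ = suc (rank (λ i → P? (suc i)) e)
... | no  _ = rank (λ i → P? (suc i)) e

rank<count : ∀ {m} {P : Fin m → Set} (P? : Decidable P) {e} → P e → rank P? e < count P?
rank<count P? {zero} Pe with P? zero
... | yes _  = s≤s z≤n
... | no ¬P0 = contradiction Pe ¬P0
rank<count P? {suc e} Pe with P? zero
... | yes _ = s≤s (rank<count (λ i → P? (suc i)) Pe)
... | no  _ = rank<count (λ i → P? (suc i)) Pe

rank-injective : ∀ {m} {P : Fin m → Set} (P? : Decidable P) {e f} →
                 P e → P f → rank P? e ≡ rank P? f → e ≡ f
rank-injective P? {zero} {zero} _ _ _ = refl
rank-injective P? {zero} {suc f} P0 _ eq with P? zero
... | yes _  = contradiction eq λ ()
... | no ¬P0 = contradiction P0 ¬P0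
rank-injective P? {suc e} {zero} _ P0 eq with P? zero
... | yes _  = contradiction eq λ ()
... | no ¬P0 = contradiction P0 ¬P0
rank-injective P? {suc e} {suc f} Pe Pf eq with P? zero
... | yes _ = cong suc (rank-injective (λ i → P? (suc i)) Pe Pf (suc-injective eq))
... | no  _ = cong suc (rank-injective (λ i → P? (suc i)) Pe Pf eq)

rank-suc-in : ∀ {m} {P : Fin (suc m) → Set} (P? : Decidable P) {e} →
              P zero → rank P? (suc e) ≡ suc (rank (λ i → P? (suc i)) e)
rank-suc-in P? P0 with P? zero
... | yes _  = refl
... | no ¬P0 = contradiction P0 ¬P0

rank-suc-out : ∀ {m} {P : Fin (suc m) → Set} (P? : Decidable P) {e} →
               ¬ P zero → rank P? (suc e) ≡ rank (λ i → P? (suc i)) e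
rank-suc-out P? ¬P0 with P? zero
... | yes P0 = contradiction P0 ¬P0
... | no _   = refl

rank-surjective : ∀ {m} {P : Fin m → Set} (P? : Decidable P) {j} →
                  j < count P? → ∃[ e ] (P e × rank P? e ≡ j)
rank-surjective {zero} P? ()
rank-surjective {suc m} P? {j} j<count with P? zero
rank-surjective {suc m} P? {zero} _ | yes P0 = zero , P0 , refl
rank-surjective {suc m} P? {suc j} (s≤s j<count) | yes P0
  with e , Pe , rank≡j ← rank-surjective (λ i → P? (suc i)) j<count
  = suc e , Pe , trans (rank-suc-in P? P0) (cong suc rank≡j)
... | no ¬P0 with e , Pe , rank≡j ← rank-surjective (λ i → P? (suc i)) j<count
  = suc e , Pe , trans (rank-suc-out P? ¬P0) rank≡j

-- Fin N contains at most N pairwise distinct elements: removing the head x of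
-- such a list and renumbering the rest by punchOut x gives a list in Fin (N - 1).

avoiding : ∀ {N} (x : Fin (suc N)) (ys : List (Fin (suc N))) → All (x ≢_) ys → List (Fin N)
avoiding x []       []             = []
avoiding x (y ∷ ys) (x≢y ∷ x∉ys) = punchOut x≢y ∷ avoiding x ys x∉ys

avoiding-length : ∀ {N} (x : Fin (suc N)) ys (x∉ys : All (x ≢_) ys) →
                  length (avoiding x ys x∉ys) ≡ length ys
avoiding-length x []       []             = refl
avoiding-length x (y ∷ ys) (_ ∷ x∉ys) = cong suc (avoiding-length x ys x∉ys)

avoiding-distinct : ∀ {N} (x : Fin (suc N)) ys (x∉ys : All (x ≢_) ys) →
                    AllPairs _≢_ ys → AllPairs _≢_ (avoiding x ys x∉ys)
avoiding-distinct x []       []             []                   = []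
avoiding-distinct x (y ∷ ys) (x≢y ∷ x∉ys) (y∉ys ∷ ys-distinct) =
  still-apart ys x∉ys y∉ys ∷ avoiding-distinct x ys x∉ys ys-distinct
  where
  still-apart : ∀ zs (x∉zs : All (x ≢_) zs) → All (y ≢_) zs →
                All (punchOut x≢y ≢_) (avoiding x zs x∉zs)
  still-apart []       []             []             = []
  still-apart (z ∷ zs) (x≢z ∷ x∉zs) (y≢z ∷ y∉zs) =
    (y≢z ∘ punchOut-injective x≢y x≢z) ∷ still-apart zs x∉zs y∉zs

distinct-bound : ∀ {N} (xs : List (Fin N)) → AllPairs _≢_ xs → length xs ≤ N
distinct-bound          []       []                  = z≤n
distinct-bound {zero}   (() ∷ _) _
distinct-bound {suc N}  (x ∷ xs) (x∉xs ∷ distinct) =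
  s≤s (subst (_≤ N) (avoiding-length x xs x∉xs)
             (distinct-bound (avoiding x xs x∉xs) (avoiding-distinct x xs x∉xs distinct)))

crossing : (F : ℕ → ℕ) (N j : ℕ) → F 0 ≤ j → j < F N → ∃[ l ] (F l ≤ j × j < F (suc l))
crossing F zero    j F0≤j j<F0 = contradiction F0≤j (<⇒≱ j<F0)
crossing F (suc N) j F0≤j j<FN with j <? F N
... | yes j<F = crossing F N j F0≤j j<F
... | no  j≮F = N , ≮⇒≥ j≮F , j<FN

module Blocks {m : ℕ} {K : Set} (_≟K_ : DecidableEquality K) (class : Fin m → K) where

  inClass : (x : K) → Decidable (λ e → class e ≡ x)
  inClass x e = class e ≟K x

  size : K → ℕ
  size x = count (inClass x)

  module Placed (offset : K → ℕ) where

    colourIn : K → Fin m → ℕ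
    colourIn x e = suc (offset x + rank (inClass x) e)

    colour : Fin m → ℕ
    colour e = colourIn (class e) e

    colour-as : ∀ {e x} → class e ≡ x → colour e ≡ colourIn x e
    colour-as refl = refl

    above-start : ∀ {e x} → class e ≡ x → offset x < colour e
    above-start refl = s≤s (m≤m+n _ _)

    below-end : ∀ {e x} → class e ≡ x → colour e ≤ offset x + size x
    below-end {e} refl = +-monoʳ-< (offset (class e)) (rank<count (inClass (class e)) refl)

    injective-within : ∀ {e f x} → class e ≡ x → class f ≡ x → colour e ≡ colour f → e ≡ f
    injective-within {x = x} ce cf same =
      rank-injective (inClass x) ce cf
        (+-cancelˡ-≡ (offset x) _ _ (suc-injective (trans (sym (colour-as ce)) (trans same (colour-as cf)))))

    block-covered : ∀ {x k} → offset x < k → k ≤ offset x + size x →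
                    ∃[ g ] (class g ≡ x × colour g ≡ k)
    block-covered {x} {suc j} (s≤s start≤j) j<end = place (rank-surjective (inClass x) within)
      where
      within : j ∸ offset x < size x
      within = +-cancelˡ-< (offset x) _ _ (subst (_< offset x + size x) (sym (m+[n∸m]≡n start≤j)) j<end)
      open ≡-Reasoning
      place : ∃[ g ] (class g ≡ x × rank (inClass x) g ≡ j ∸ offset x) →
              ∃[ g ] (class g ≡ x × colour g ≡ suc j)
      place (g , cg , rank≡) = g , cg , (begin
        colour g                            ≡⟨ colour-as cg ⟩
        suc (offset x + rank (inClass x) g) ≡⟨ cong (λ r → suc (offset x + r)) rank≡ ⟩
        suc (offset x + (j ∸ offset x))     ≡⟨ cong suc (m+[n∸m]≡n start≤j) ⟩
        suc j                               ∎)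

    block-interval : ∀ {e f x k} → class e ≡ x → class f ≡ x → colour e ≤ k → k ≤ colour f →
                     ∃[ g ] (class g ≡ x × colour g ≡ k)
    block-interval ce cf e≤k k≤f = block-covered (<-≤-trans (above-start ce) e≤k) (≤-trans k≤f (below-end cf))

    module Abutting (x y : K) (abut : offset x + size x ≡ offset y) where

      InPair : Fin m → Set
      InPair e = class e ≡ x ⊎ class e ≡ y

      x-below-y : ∀ {e f} → class e ≡ x → class f ≡ y → colour e < colour f
      x-below-y ce cf = ≤-<-trans (below-end ce) (subst (_< colour _) (sym abut) (above-start cf))

      pair-start : ∀ {e} → InPair e → offset x < colour e
      pair-start (inj₁ ce) = above-start ce
      pair-start (inj₂ ce) = ≤-<-trans (subst (offset x ≤_) abut (m≤m+n _ _)) (above-start ce)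

      pair-end : ∀ {e} → InPair e → colour e ≤ offset y + size y
      pair-end (inj₁ ce) = ≤-trans (subst (colour _ ≤_) abut (below-end ce)) (m≤m+n _ _)
      pair-end (inj₂ ce) = below-end ce

      pair-injective : ∀ {e f} → InPair e → InPair f → colour e ≡ colour f → e ≡ f
      pair-injective (inj₁ ce) (inj₁ cf) same = injective-within ce cf same
      pair-injective (inj₂ ce) (inj₂ cf) same = injective-within ce cf same
      pair-injective (inj₁ ce) (inj₂ cf) same = contradiction same (<⇒≢ (x-below-y ce cf))
      pair-injective (inj₂ ce) (inj₁ cf) same = contradiction (sym same) (<⇒≢ (x-below-y cf ce))

      pair-interval : ∀ {e f k} → InPair e → InPair f → colour e ≤ k → k ≤ colour f →
                      ∃[ g ] (InPair g × colour g ≡ k)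
      pair-interval {k = k} pe pf e≤k k≤f with k ≤? offset y
      ... | yes k≤start
        with g , cg , eq ← block-covered (<-≤-trans (pair-start pe) e≤k) (subst (k ≤_) (sym abut) k≤start)
        = g , inj₁ cg , eq
      ... | no k≰start
        with g , cg , eq ← block-covered (≰⇒> k≰start) (≤-trans k≤f (pair-end pf))
        = g , inj₂ cg , eq

ProperAt : (G : Multigraph) → (Fin (m G) → ℕ) → Fin (n G) → Set
ProperAt G col v = ∀ e f → Incident G v e → Incident G v f → col e ≡ col f → e ≡ f

IntervalAt : (G : Multigraph) → (Fin (m G) → ℕ) → Fin (n G) → Set
IntervalAt G col v = ∀ e f k → Incident G v e → Incident G v f → col e ≤ k → k ≤ col f →
                     ∃[ g ] (Incident G v g × col g ≡ k)

module _ (G : Multigraph) (col : Fin (m G) → ℕ) (v : Fin (n G)) {S : Fin (m G) → Set}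
         (edges-at : ∀ e → Incident G v e ⇔ S e) where

  proper-via : (∀ {e f} → S e → S f → col e ≡ col f → e ≡ f) → ProperAt G col v
  proper-via injective e f ve vf = injective (to (edges-at e) ve) (to (edges-at f) vf)

  interval-via : (∀ {e f k} → S e → S f → col e ≤ k → k ≤ col f → ∃[ g ] (S g × col g ≡ k)) →
                 IntervalAt G col v
  interval-via interval e f k ve vf e≤k k≤f
    with g , Sg , eq ← interval (to (edges-at e) ve) (to (edges-at f) vf) e≤k k≤f
    = g , from (edges-at g) Sg , eq

-- A colouring with positive colours up to t, locally proper and interval, using
-- every colour 1, …, t, witnesses membership in 𝔑 (t ≥ 1 as there is an edge).
in-𝔑-from : (G : Multigraph) (col : Fin (m G) → ℕ) (t : ℕ) → Fin (m G) →
            (∀ e → 1 ≤ col e) → (∀ e → col e ≤ t) →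
            (∀ v → ProperAt G col v) → (∀ v → IntervalAt G col v) →
            (∀ k → 1 ≤ k → k ≤ t → ∃[ e ] col e ≡ k) → InN G
in-𝔑-from G col t e₀ positive bounded proper interval all-used =
  t , ≤-trans (positive e₀) (bounded e₀) , record
    { col      = col
    ; range    = λ e → positive e , bounded e
    ; proper   = λ e f v → proper v e f
    ; allUsed  = all-used
    ; interval = interval
    }

Joins : (G : Multigraph) → Fin (m G) → Fin (n G) → Fin (n G) → Set
Joins G e u w = ∀ v → Incident G v e ⇔ (v ≡ u ⊎ v ≡ w)

-- The centre sees every colour once; a leaf sees the block of its own edges.

module Star (G : Multigraph) (c : Fin (n G)) (leaf : Fin (m G) → Fin (n G))
            (joins : ∀ e → Joins G e c (leaf e)) where

  key : Fin (m G) → ℕ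
  key e = toℕ (leaf e)

  open Blocks ℕₚ._≟_ key

  offset : ℕ → ℕ
  offset zero    = 0
  offset (suc l) = offset l + size l

  open Placed offset

  t : ℕ
  t = offset (n G)

  offset-mono : ∀ {l l'} → l ≤′ l' → offset l ≤ offset l'
  offset-mono ≤′-refl        = ≤-refl
  offset-mono (≤′-step l≤l') = ≤-trans (offset-mono l≤l') (m≤m+n _ _)

  key-sorted : ∀ {e f} → key e < key f → colour e < colour f
  key-sorted ke<kf = ≤-<-trans (≤-trans (below-end refl) (offset-mono (≤⇒≤′ ke<kf))) (above-start refl)

  colour-injective : ∀ {e f} → colour e ≡ colour f → e ≡ f
  colour-injective {e} {f} same with <-cmp (key e) (key f)
  ... | tri< ke<kf _ _ = contradiction same (<⇒≢ (key-sorted ke<kf))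
  ... | tri≈ _ ke≡kf _ = injective-within refl (sym ke≡kf) same
  ... | tri> _ _ kf<ke = contradiction (sym same) (<⇒≢ (key-sorted kf<ke))

  colour≤t : ∀ e → colour e ≤ t
  colour≤t e = ≤-trans (below-end refl) (offset-mono (≤⇒≤′ (toℕ<n (leaf e))))

  -- colour k lies in the block of the first leaf whose block ends at or after k
  all-colours : ∀ k → 1 ≤ k → k ≤ t → ∃[ g ] colour g ≡ k
  all-colours (suc j) _ j<t
    with l , start≤j , j<end ← crossing offset (n G) j z≤n j<t
    with g , _ , eq ← block-covered {l} (s≤s start≤j) j<end
    = g , eq

  hub : ∀ e → Incident G c e
  hub e = from (joins e c) (inj₁ refl)

  leaf-edges : ∀ {v} → v ≢ c → ∀ e → Incident G v e ⇔ key e ≡ toℕ v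
  leaf-edges v≢c e = mk⇔ (Sum.[ (λ v≡c → contradiction v≡c v≢c) , cong toℕ ∘ sym ] ∘ to (joins e _))
                         (λ ke≡v → from (joins e _) (inj₂ (sym (toℕ-injective ke≡v))))

  proper-at : ∀ v → ProperAt G colour v
  proper-at v with v ≟ c
  ... | yes refl = λ _ _ _ _ → colour-injective
  ... | no  v≢c  = proper-via G colour v (leaf-edges v≢c) (λ ce cf → injective-within ce cf)

  interval-at : ∀ v → IntervalAt G colour v
  interval-at v with v ≟ c
  ... | yes refl = λ e f k _ _ e≤k k≤f →
    let g , eq = all-colours k (≤-trans (s≤s z≤n) e≤k) (≤-trans k≤f (colour≤t f)) in g , hub g , eq
  ... | no v≢c = interval-via G colour v (leaf-edges v≢c) block-interval

  in-𝔑 : Fin (m G) → InN G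
  in-𝔑 e₀ = in-𝔑-from G colour t e₀ (λ _ → s≤s z≤n) colour≤t proper-at interval-at all-colours

-- With p, r the sizes of the classes (true , true),
-- (false , false) and h = p ⊔ r, these classes occupy (h - p, h] and (h - r, h],
-- while (true , false) and (false , true) start at h + 1.  Vertex A x meets the
-- classes (x , x) and (x , ¬ x), vertex B y the classes (y , y) and (¬ y , y): in
-- both cases two abutting blocks.

module Square (G : Multigraph) (A B : Bool → Fin (n G)) (α β : Fin (m G) → Bool)
              (joins : ∀ e → Joins G e (A (α e)) (B (β e)))
              (A-injective : ∀ {x y} → A x ≡ A y → x ≡ y)
              (B-injective : ∀ {x y} → B x ≡ B y → x ≡ y)
              (A≢B : ∀ x y → A x ≢ B y) where

  class : Fin (m G) → Bool × Bool
  class e = α e , β e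

  open Blocks (≡-dec Boolₚ._≟_ Boolₚ._≟_) class

  h : ℕ
  h = size (true , true) ⊔ size (false , false)

  offset : Bool × Bool → ℕ
  offset (true  , true)  = h ∸ size (true , true)
  offset (false , false) = h ∸ size (false , false)
  offset (true  , false) = h
  offset (false , true)  = h

  open Placed offset

  t : ℕ
  t = h + (size (true , false) ⊔ size (false , true))

  parallel-offset : ∀ x → offset (x , x) ≡ h ∸ size (x , x)
  parallel-offset true  = refl
  parallel-offset false = refl

  parallel-end : ∀ x → offset (x , x) + size (x , x) ≡ h
  parallel-end true  = m∸n+n≡m (m≤m⊔n (size (true , true)) (size (false , false)))
  parallel-end false = m∸n+n≡m (m≤n⊔m (size (true , true)) (size (false , false)))

  abut-A : ∀ x → offset (x , x) + size (x , x) ≡ offset (x , not x)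
  abut-A true  = parallel-end true
  abut-A false = parallel-end false

  abut-B : ∀ y → offset (y , y) + size (y , y) ≡ offset (not y , y)
  abut-B true  = parallel-end true
  abut-B false = parallel-end false

  -- a parallel class fills all of [1, h], a crossing class all of (h, t]
  widest-parallel : ∃[ x ] (size (x , x) ≡ h)
  widest-parallel with ⊔-sel (size (true , true)) (size (false , false))
  ... | inj₁ eq = true  , sym eq
  ... | inj₂ eq = false , sym eq

  widest-crossing : ∃[ z ] (offset z ≡ h × h + size z ≡ t)
  widest-crossing with ⊔-sel (size (true , false)) (size (false , true))
  ... | inj₁ eq = (true  , false) , refl , cong (h +_) (sym eq)
  ... | inj₂ eq = (false , true)  , refl , cong (h +_) (sym eq)

  block-end≤t : ∀ z → offset z + size z ≤ t
  block-end≤t (true  , true)  = subst (_≤ t) (sym (parallel-end true))  (m≤m+n h _)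
  block-end≤t (false , false) = subst (_≤ t) (sym (parallel-end false)) (m≤m+n h _)
  block-end≤t (true  , false) = +-monoʳ-≤ h (m≤m⊔n _ _)
  block-end≤t (false , true)  = +-monoʳ-≤ h (m≤n⊔m _ _)

  colour≤t : ∀ e → colour e ≤ t
  colour≤t e = ≤-trans (below-end refl) (block-end≤t (class e))

  all-colours : ∀ k → 1 ≤ k → k ≤ t → ∃[ g ] colour g ≡ k
  all-colours k 1≤k k≤t with k ≤? h
  ... | yes k≤h
    with x , full ← widest-parallel
    with g , _ , eq ← block-covered {x , x}
                        (subst (_< k) (sym (trans (parallel-offset x) (trans (cong (h ∸_) full) (n∸n≡0 h)))) 1≤k)
                        (subst (k ≤_) (sym (parallel-end x)) k≤h)
    = g , eq
  ... | no k≰h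
    with z , start , end ← widest-crossing
    with g , _ , eq ← block-covered {z} (subst (_< k) (sym start) (≰⇒> k≰h))
                                        (subst (k ≤_) (sym (trans (cong (_+ size z) start) end)) k≤t)
    = g , eq

  second-either : ∀ x e → β e ≡ x ⊎ β e ≡ not x
  second-either x e with β e Boolₚ.≟ x
  ... | yes eq = inj₁ eq
  ... | no  ne = inj₂ (¬-not ne)

  first-either : ∀ y e → α e ≡ y ⊎ α e ≡ not y
  first-either y e with α e Boolₚ.≟ y
  ... | yes eq = inj₁ eq
  ... | no  ne = inj₂ (¬-not ne)

  edges-at-A : ∀ x e → Incident G (A x) e ⇔ (class e ≡ (x , x) ⊎ class e ≡ (x , not x))
  edges-at-A x e = ⇔-trans incident (mk⇔ split (Sum.[ cong proj₁ , cong proj₁ ]))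
    where
    incident : Incident G (A x) e ⇔ (α e ≡ x)
    incident = mk⇔ (Sum.[ sym ∘ A-injective , (λ eq → contradiction eq (A≢B _ _)) ] ∘ to (joins e (A x)))
                   (λ αe≡x → from (joins e (A x)) (inj₁ (cong A (sym αe≡x))))
    split : α e ≡ x → class e ≡ (x , x) ⊎ class e ≡ (x , not x)
    split αe≡x = Sum.map (cong₂ _,_ αe≡x) (cong₂ _,_ αe≡x) (second-either x e)

  edges-at-B : ∀ y e → Incident G (B y) e ⇔ (class e ≡ (y , y) ⊎ class e ≡ (not y , y))
  edges-at-B y e = ⇔-trans incident (mk⇔ split (Sum.[ cong proj₂ , cong proj₂ ]))
    where
    incident : Incident G (B y) e ⇔ (β e ≡ y)
    incident = mk⇔ (Sum.[ (λ eq → contradiction (sym eq) (A≢B _ _)) , sym ∘ B-injective ] ∘ to (joins e (B y)))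
                   (λ βe≡y → from (joins e (B y)) (inj₂ (cong B (sym βe≡y))))
    split : β e ≡ y → class e ≡ (y , y) ⊎ class e ≡ (not y , y)
    split βe≡y = Sum.map (λ αe≡y → cong₂ _,_ αe≡y βe≡y) (λ αe≡¬y → cong₂ _,_ αe≡¬y βe≡y) (first-either y e)

  module AtA (x : Bool) = Abutting (x , x) (x , not x) (abut-A x)
  module AtB (y : Bool) = Abutting (y , y) (not y , y) (abut-B y)

  -- every vertex with an edge is some A x or some B y
  proper-at : ∀ v → ProperAt G colour v
  proper-at v e f ve vf with to (joins e v) ve
  ... | inj₁ refl = proper-via G colour _ (edges-at-A (α e)) (AtA.pair-injective (α e)) e f ve vf
  ... | inj₂ refl = proper-via G colour _ (edges-at-B (β e)) (AtB.pair-injective (β e)) e f ve vf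

  interval-at : ∀ v → IntervalAt G colour v
  interval-at v e f k ve vf with to (joins e v) ve
  ... | inj₁ refl = interval-via G colour _ (edges-at-A (α e)) (AtA.pair-interval (α e)) e f k ve vf
  ... | inj₂ refl = interval-via G colour _ (edges-at-B (β e)) (AtB.pair-interval (β e)) e f k ve vf

  in-𝔑 : Fin (m G) → InN G
  in-𝔑 e₀ = in-𝔑-from G colour t e₀ (λ _ → s≤s z≤n) colour≤t proper-at interval-at all-colours

module Bipartition (G : Multigraph) (side : Fin (n G) → Bool)
                   (bip : ∀ e → side (proj₁ (ends G e)) ≢ side (proj₂ (ends G e))) where

  endOn : Bool → Fin (m G) → Fin (n G)
  endOn s e = if does (side (proj₁ (ends G e)) Boolₚ.≟ s) then proj₁ (ends G e) else proj₂ (ends G e)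

  endOn-first : ∀ {s e} → side (proj₁ (ends G e)) ≡ s → endOn s e ≡ proj₁ (ends G e)
  endOn-first {s} {e} p rewrite dec-true (side (proj₁ (ends G e)) Boolₚ.≟ s) p = refl

  endOn-second : ∀ {s e} → side (proj₁ (ends G e)) ≢ s → endOn s e ≡ proj₂ (ends G e)
  endOn-second {s} {e} ¬p rewrite dec-false (side (proj₁ (ends G e)) Boolₚ.≟ s) ¬p = refl

  side-endOn : ∀ s e → side (endOn s e) ≡ s
  side-endOn s e with side (proj₁ (ends G e)) Boolₚ.≟ s
  ... | yes p = p
  ... | no ¬p = trans (¬-not (bip e ∘ sym)) (sym (¬-not (¬p ∘ sym)))

  joins-ends : ∀ e → Joins G e (proj₁ (ends G e)) (proj₂ (ends G e))
  joins-ends e v = mk⇔ (Sum.map sym sym) (Sum.map sym sym)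

  endOn-either : ∀ {s s'} → s ≢ s' → ∀ e →
                 (endOn s e ≡ proj₁ (ends G e) × endOn s' e ≡ proj₂ (ends G e)) ⊎
                 (endOn s e ≡ proj₂ (ends G e) × endOn s' e ≡ proj₁ (ends G e))
  endOn-either {s} {s'} s≢s' e with side (proj₁ (ends G e)) Boolₚ.≟ s
  ... | yes p = inj₁ (refl , endOn-second (s≢s' ∘ trans (sym p)))
  ... | no ¬p = inj₂ (refl , endOn-first (trans (¬-not ¬p) (sym (¬-not (s≢s' ∘ sym)))))

  joins-sides : ∀ {s s'} → s ≢ s' → ∀ e → Joins G e (endOn s e) (endOn s' e)
  joins-sides s≢s' e with endOn-either s≢s' e
  ... | inj₁ (p , q) = subst₂ (Joins G e) (sym p) (sym q) (joins-ends e)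
  ... | inj₂ (p , q) = subst₂ (Joins G e) (sym p) (sym q) (λ v → ⇔-trans (joins-ends e v) (mk⇔ Sum.swap Sum.swap))

module SmallBipartite (G : Multigraph) (n≤4 : n G ≤ 4) (side : Fin (n G) → Bool)
                      (bip : ∀ e → side (proj₁ (ends G e)) ≢ side (proj₂ (ends G e)))
                      (e₀ : Fin (m G)) where

  open Bipartition G side bip

  c d : Fin (n G)
  c = proj₁ (ends G e₀)
  d = proj₂ (ends G e₀)

  alone-or-partner : ∀ u → (∀ v → side v ≡ side u → v ≡ u) ⊎ ∃[ v ] (v ≢ u × side v ≡ side u)
  alone-or-partner u with any? (λ v → ¬? (v ≟ u) ×-dec (side v Boolₚ.≟ side u))
  ... | yes partner = inj₂ partner
  ... | no  none    = inj₁ λ v sv → decidable-stable (v ≟ u) (λ v≢u → none (v , v≢u , sv))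

  star-at : ∀ u → (∀ v → side v ≡ side u → v ≡ u) → InN G
  star-at u alone = Star.in-𝔑 G u (endOn (not (side u))) joins e₀
    where
    joins : ∀ e → Joins G e u (endOn (not (side u)) e)
    joins e = subst (λ w → Joins G e w (endOn (not (side u)) e)) (alone _ (side-endOn (side u) e))
                    (joins-sides (not-¬ refl) e)

  -- two distinct vertices on each side exhaust their side, as five vertices do not fit
  exhaust : ∀ {s s' u w x y} → s ≢ s' → u ≢ w → x ≢ y →
            side u ≡ s → side w ≡ s → side x ≡ s' → side y ≡ s' →
            ∀ v → side v ≡ s → v ≡ u ⊎ v ≡ w
  exhaust {s} {s'} {u} {w} {x} {y} s≢s' u≢w x≢y su sw sx sy v sv with v ≟ u | v ≟ w
  ... | yes v≡u | _       = inj₁ v≡u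
  ... | no  _   | yes v≡w = inj₂ v≡w
  ... | no  v≢u | no  v≢w =
    contradiction (≤-trans (distinct-bound (v ∷ u ∷ w ∷ x ∷ y ∷ []) five-distinct) n≤4) (<-irrefl refl)
    where
    apart : ∀ {a b} → side a ≡ s → side b ≡ s' → a ≢ b
    apart sa sb a≡b = s≢s' (trans (sym sa) (trans (cong side a≡b) sb))
    five-distinct : AllPairs _≢_ (v ∷ u ∷ w ∷ x ∷ y ∷ [])
    five-distinct = (v≢u ∷ v≢w ∷ apart sv sx ∷ apart sv sy ∷ [])
                  ∷ (u≢w ∷ apart su sx ∷ apart su sy ∷ [])
                  ∷ (apart sw sx ∷ apart sw sy ∷ [])
                  ∷ (x≢y ∷ [])
                  ∷ [] ∷ []

  module TwoOnSide (s : Bool) (u w : Fin (n G)) (u≢w : u ≢ w) (su : side u ≡ s) (sw : side w ≡ s)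
                   (exhausted : ∀ v → side v ≡ s → v ≡ u ⊎ v ≡ w) where

    vertex : Bool → Fin (n G)
    vertex true  = u
    vertex false = w

    which : Fin (m G) → Bool
    which e = does (endOn s e ≟ u)

    vertex-which : ∀ e → vertex (which e) ≡ endOn s e
    vertex-which e with endOn s e ≟ u
    ... | yes end≡u = sym end≡u
    ... | no  end≢u = Sum.[ (λ end≡u → contradiction end≡u end≢u) , sym ]′ (exhausted _ (side-endOn s e))

    vertex-injective : ∀ {x y} → vertex x ≡ vertex y → x ≡ y
    vertex-injective {true}  {true}  _   = refl
    vertex-injective {false} {false} _   = refl
    vertex-injective {true}  {false} u≡w = contradiction u≡w u≢w
    vertex-injective {false} {true}  w≡u = contradiction (sym w≡u) u≢w

    side-vertex : ∀ x → side (vertex x) ≡ s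
    side-vertex true  = su
    side-vertex false = sw

  square : ∀ {a b} → a ≢ c → side a ≡ side c → b ≢ d → side b ≡ side d → InN G
  square {a} {b} a≢c sa b≢d sb =
    Square.in-𝔑 G SideC.vertex SideD.vertex SideC.which SideD.which joins
                 SideC.vertex-injective SideD.vertex-injective apart e₀
    where
    module SideC = TwoOnSide (side c) c a (a≢c ∘ sym) refl sa
                             (exhaust (bip e₀) (a≢c ∘ sym) (b≢d ∘ sym) refl sa refl sb)
    module SideD = TwoOnSide (side d) d b (b≢d ∘ sym) refl sb
                             (exhaust (bip e₀ ∘ sym) (b≢d ∘ sym) (a≢c ∘ sym) refl sb refl sa)
    joins : ∀ e → Joins G e (SideC.vertex (SideC.which e)) (SideD.vertex (SideD.which e))
    joins e = subst₂ (Joins G e) (sym (SideC.vertex-which e)) (sym (SideD.vertex-which e))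
                     (joins-sides (bip e₀) e)
    apart : ∀ x y → SideC.vertex x ≢ SideD.vertex y
    apart x y same = bip e₀ (trans (sym (SideC.side-vertex x)) (trans (cong side same) (SideD.side-vertex y)))

  in-𝔑 : InN G
  in-𝔑 with alone-or-partner c | alone-or-partner d
  ... | inj₁ c-alone          | _                   = star-at c c-alone
  ... | inj₂ _                | inj₁ d-alone        = star-at d d-alone
  ... | inj₂ (a , a≢c , sa)   | inj₂ (b , b≢d , sb) = square a≢c sa b≢d sb

first-edge : ∀ {G u v} → Walk G u v → u ≢ v → Fin (m G)
first-edge here             u≢u = contradiction refl u≢u
first-edge (step e _ _ _) _   = e

distinct-pair : ∀ {N} → 2 ≤ N → Σ[ u ∈ Fin N ] Σ[ v ∈ Fin N ] u ≢ v
distinct-pair (s≤s (s≤s _)) = zero , suc zero , λ ()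

theorem14 : (G : Multigraph) → 2 ≤ n G → n G ≤ 4 → Connected G → Bipartite G → InN G
theorem14 G 2≤n n≤4 connected (side , bipartite)
  with u , v , u≢v ← distinct-pair 2≤n
  = SmallBipartite.in-𝔑 G n≤4 side bipartite (first-edge (connected u v) u≢v)
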